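{- Let $\lambda$ be a strict partition, $k\ge1$, and let $T$ be a semi-standard shifted $k$-ribbon tableau of shape $\lambda$ with $n$ ribbons. Its standardization $St(T)$ is well defined, and it is a standard shifted $k$-ribbon tableau of shape $\lambda$.
   Context: Conventions. Diagrams are drawn in French convention, with rows numbered from the bottom. A strict partition $\lambda=(\lambda_1>\cdots>\lambda_\ell>0)$ is identified with its shifted diagram $\{(c,r):1\le r\le\ell,\ r\le c\le r+\lambda_r-1\}$. The diagonal value is $c-r+1$, and the main diagonal consists of the cells of value $1$. A subset $R\subseteq\lambda$ is removable if $\lambda\setminus R$ is a shifted diagram. Ribbons. A single ribbon is a nonempty edge-connected skew-shifted diagram with cells on distinct diagonals. Its head $H(R)$ and tail $T(R)$ are its cells of largest and smallest diagonal value. A double ribbon in $\lambda$ is a union $R\cup S$ of disjoint single ribbons with $|R|\ge|S|$ such that $T(R)$ is on the main diagonal of $\lambda$, $T(S)$ is on the main diagonal of $\lambda\setminus R$, and $R\cup S$ is skew-shifted. Its head is $H(R)$. A $k$-ribbon is a single or double ribbon with $k$ cells. The diagonal value of a ribbon is that of its head. A $k$-core is a shifted diagram with no removable $k$-ribbon. Strips. A horizontal (resp. vertical) $k$-ribbon strip $\lambda\setminus\lambda^{(0)}$ is given by a chain $\lambda^{(0)}\subset\cdots\subset\lambda^{(t)}=\lambda$ of removable $k$-ribbon additions $R_i$, with $H(R_i)$ in a column strictly right of (resp. a row strictly above) $H(R_{i-1})$. Semi-standard tableaux. A semi-standard shifted $k$-ribbon tableau is a chain $\lambda^{(0)}\subseteq\lambda^{(1')}\subseteq\lambda^{(1)}\subseteq\lambda^{(2')}\subseteq\cdots\subseteq\lambda^{(m)}=\lambda$,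 with strip decompositions, such that: - $\lambda^{(0)}$ is a $k$-core; - $\lambda^{(i')}\setminus\lambda^{(i-1)}$ is a vertical strip, whose ribbons are labelled $i'$; - $\lambda^{(i)}\setminus\lambda^{(i')}$ is a horizontal strip, whose ribbons are labelled $i$. Standard tableaux. A standard shifted $k$-ribbon tableau is a chain $\lambda^{(0)}\subset\cdots\subset\lambda^{(n)}=\lambda$ with $\lambda^{(0)}$ a $k$-core and each $\lambda^{(j)}\setminus\lambda^{(j-1)}$ a removable $k$-ribbon of $\lambda^{(j)}$, labelled $j$. Standardization. $St(T)$ relabels the ribbons of $T$ by $1,\dots,n$ as follows. Ribbons are numbered in the order of their labels, $1'<1<2'<2<\cdots$. Among ribbons with the same unmarked label $i$, the numbering increases with the diagonal values of the ribbons. Among ribbons with the same marked label $i'$, the numbering decreases with the diagonal values. -}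

module Defs where

open import Level using (0ℓ)
open import Data.Nat using (ℕ; zero; suc; _+_; _∸_; _≤_; _<_; _>_)
open import Data.Bool using (Bool; true; false)
open import Data.Product using (Σ; Σ-syntax; ∃; _×_; _,_; proj₁; proj₂)
open import Data.Sum using (_⊎_)
open import Data.List using (List; []; _∷_; length; _++_)
open import Data.List.Relation.Unary.All using (All)
open import Data.List.Relation.Unary.Linked using (Linked)
open import Data.List.Relation.Unary.Unique.Propositional using (Unique)
open import Data.List.Membership.Propositional renaming (_∈_ to _∈ₗ_)
open import Relation.Nullary using (¬_)
open import Relation.Binary.PropositionalEquality using (_≡_)
open import Function.Bundles using (_⇔_)

-- Cells, diagrams (French convention, rows numbered from the bottom)

-- a cell (c , r) : column c, row r (both 1-indexed)
Cell : Set
Cell = ℕ × ℕ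

col : Cell → ℕ
col (c , r) = c

row : Cell → ℕ
row (c , r) = r

-- diagonal value c - r + 1 (cells of shifted diagrams satisfy r ≤ c)
diag : Cell → ℕ
diag (c , r) = suc c ∸ r

CellSet : Set₁
CellSet = Cell → Set

_⊆ₛ_ : CellSet → CellSet → Set
A ⊆ₛ B = ∀ x → A x → B x

_≐ₛ_ : CellSet → CellSet → Set
A ≐ₛ B = (A ⊆ₛ B) × (B ⊆ₛ A)

_∪ₛ_ : CellSet → CellSet → CellSet
(A ∪ₛ B) x = A x ⊎ B x

_∖ₛ_ : CellSet → CellSet → CellSet
(A ∖ₛ B) x = A x × ¬ B x

Disjoint : CellSet → CellSet → Set
Disjoint A B = ∀ x → A x → B x → ⊥'
  where open import Data.Empty renaming (⊥ to ⊥')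

Card : CellSet → ℕ → Set
Card X n = Σ[ xs ∈ List Cell ] (Unique xs × (∀ x → X x ⇔ (x ∈ₗ xs)) × length xs ≡ n)

StrictPartition : List ℕ → Set
StrictPartition λ' = All (λ p → 0 < p) λ' × Linked _>_ λ'

-- λ_r (1-indexed); 0 when r is out of range
part : List ℕ → ℕ → ℕ
part []       _             = 0
part (x ∷ xs) zero          = 0
part (x ∷ xs) (suc zero)    = x
part (x ∷ xs) (suc (suc r)) = part xs (suc r)

Sh : List ℕ → CellSet
Sh λ' (c , r) = (1 ≤ r) × (r ≤ c) × (c < r + part λ' r)

IsShifted : CellSet → Set
IsShifted X = Σ[ μ ∈ List ℕ ] (StrictPartition μ × X ≐ₛ Sh μ)

SkewShifted : CellSet → Set
SkewShifted X = Σ[ ν ∈ List ℕ ] Σ[ ρ ∈ List ℕ ]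
  (StrictPartition ν × StrictPartition ρ × (Sh ρ ⊆ₛ Sh ν) × X ≐ₛ (Sh ν ∖ₛ Sh ρ))

Adjacent : Cell → Cell → Set
Adjacent (c , r) (c' , r') =
  (c ≡ c' × (suc r ≡ r' ⊎ suc r' ≡ r)) ⊎ (r ≡ r' × (suc c ≡ c' ⊎ suc c' ≡ c))

data Path (X : CellSet) : Cell → Cell → Set where
  here : ∀ {x} → X x → Path X x x
  step : ∀ {x y z} → X x → Adjacent x y → Path X y z → Path X x z

EdgeConnected : CellSet → Set
EdgeConnected X = ∀ x y → X x → X y → Path X x y

Nonempty : CellSet → Set
Nonempty X = ∃ X

DistinctDiagonals : CellSet → Set
DistinctDiagonals X = ∀ x y → X x → X y → diag x ≡ diag y → x ≡ y

SingleRibbon : CellSet → Set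
SingleRibbon X = Nonempty X × EdgeConnected X × SkewShifted X × DistinctDiagonals X

IsHead : CellSet → Cell → Set
IsHead X h = X h × (∀ y → X y → diag y ≤ diag h)

IsTail : CellSet → Cell → Set
IsTail X t = X t × (∀ y → X y → diag t ≤ diag y)

data KRibbonIn (k : ℕ) (λ' : List ℕ) (X : CellSet) (h : Cell) : Set₁ where
  single : SingleRibbon X → Card X k → IsHead X h → KRibbonIn k λ' X h
  double : (R S : CellSet) (a b : ℕ) (tR tS : Cell) →
           SingleRibbon R → SingleRibbon S → Disjoint R S →
           Card R a → Card S b → b ≤ a → a + b ≡ k →
           X ≐ₛ (R ∪ₛ S) →
           IsTail R tR → Sh λ' tR → diag tR ≡ 1 →
           IsTail S tS → (Sh λ' ∖ₛ R) tS → diag tS ≡ 1 →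
           SkewShifted (R ∪ₛ S) →
           IsHead R h →
           KRibbonIn k λ' X h

record RibbonAdd (k : ℕ) (μ λ' : List ℕ) : Set₁ where
  field
    cells     : CellSet
    head      : Cell
    strictμ   : StrictPartition μ
    inside    : cells ⊆ₛ Sh λ'
    removable : (Sh λ' ∖ₛ cells) ≐ₛ Sh μ
    ribbon    : KRibbonIn k λ' cells head

dval : ∀ {k μ λ'} → RibbonAdd k μ λ' → ℕ
dval r = diag (RibbonAdd.head r)

Core : ℕ → List ℕ → Set₁
Core k λ' = ¬ (Σ[ μ ∈ List ℕ ] RibbonAdd k μ λ')

data Chain (k : ℕ) : List ℕ → List ℕ → Set₁ where
  []  : ∀ {λ'} → Chain k λ' λ'
  _∷_ : ∀ {λ₀ λ₁ λ₂} → RibbonAdd k λ₀ λ₁ → Chain k λ₁ λ₂ → Chain k λ₀ λ₂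

heads : ∀ {k μ λ'} → Chain k μ λ' → List Cell
heads []      = []
heads (r ∷ c) = RibbonAdd.head r ∷ heads c

chainLength : ∀ {k μ λ'} → Chain k μ λ' → ℕ
chainLength []      = 0
chainLength (_ ∷ c) = suc (chainLength c)

HorizontalStrip : ∀ {k μ λ'} → Chain k μ λ' → Set
HorizontalStrip c = Linked (λ a b → col a < col b) (heads c)

VerticalStrip : ∀ {k μ λ'} → Chain k μ λ' → Set
VerticalStrip c = Linked (λ a b → row a < row b) (heads c)

-- stages i, i+1, ... : for each i a vertical strip (label i') followed by a
-- horizontal strip (label i)
data Stages (k : ℕ) : List ℕ → List ℕ → Set₁ where
  end   : ∀ {λ'} → Stages k λ' λ'
  stage : ∀ {λa λb λc λd} →
          (v : Chain k λa λb) → VerticalStrip v →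
          (h : Chain k λb λc) → HorizontalStrip h →
          Stages k λc λd → Stages k λa λd

record SemiStandardTableau (k : ℕ) (λ' : List ℕ) : Set₁ where
  field
    core       : List ℕ
    coreStrict : StrictPartition core
    isCore     : Core k core
    stages     : Stages k core λ'

-- labelled ribbon: label i (marked = true means i')
record LRibbon : Set₁ where
  constructor lrib
  field
    label  : ℕ
    marked : Bool
    dv     : ℕ
    cells  : CellSet

chainRibbons : ∀ {k μ λ'} → ℕ → Bool → Chain k μ λ' → List LRibbon
chainRibbons i m []      = []
chainRibbons i m (r ∷ c) = lrib i m (dval r) (RibbonAdd.cells r) ∷ chainRibbons i m c

stagesRibbons : ∀ {k μ λ'} → ℕ → Stages k μ λ' → List LRibbon
stagesRibbons i end               = []
stagesRibbons i (stage v _ h _ s) =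
  chainRibbons i true v ++ chainRibbons i false h ++ stagesRibbons (suc i) s

-- all ribbons of T with their labels (labels start at 1)
ribbons : ∀ {k λ'} → SemiStandardTableau k λ' → List LRibbon
ribbons T = stagesRibbons 1 (SemiStandardTableau.stages T)

numRibbons : ∀ {k λ'} → SemiStandardTableau k λ' → ℕ
numRibbons T = length (ribbons T)

data _≺_ (a b : LRibbon) : Set where
  label< : LRibbon.label a < LRibbon.label b → a ≺ b
  mark<  : LRibbon.label a ≡ LRibbon.label b →
           LRibbon.marked a ≡ true → LRibbon.marked b ≡ false → a ≺ b
  unmarked< : LRibbon.label a ≡ LRibbon.label b →
           LRibbon.marked a ≡ false → LRibbon.marked b ≡ false →
           LRibbon.dv a < LRibbon.dv b → a ≺ b
  marked< : LRibbon.label a ≡ LRibbon.label b →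
           LRibbon.marked a ≡ true → LRibbon.marked b ≡ true →
           LRibbon.dv b < LRibbon.dv a → a ≺ b

record StandardTableau (k : ℕ) (λ' : List ℕ) : Set₁ where
  field
    core       : List ℕ
    coreStrict : StrictPartition core
    isCore     : Core k core
    chain      : Chain k core λ'

-- cells of the ribbons labelled 1, 2, ..., n in order
chainCells : ∀ {k μ λ'} → Chain k μ λ' → List CellSet
chainCells []      = []
chainCells (r ∷ c) = RibbonAdd.cells r ∷ chainCells c

module Submission where

-- The ribbons of T, listed as T builds them (strip 1', strip 1, strip 2',
-- ...), are already in standardization order: labels increase from strip to
-- strip, and inside a strip the geometry forces the diagonal values of the
-- heads to increase along a horizontal strip and to decrease along a vertical
-- one.  Hence the list of ribbons is a chain for ≺ (which makes any two
-- ribbons comparable and St(T) well defined), and concatenating the strips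
-- of T yields a standard tableau with the same core whose i-th ribbon is the
-- i-th ribbon in ≺-order.
--
-- The geometric input is that the head of a removable k-ribbon is its cell of
-- largest diagonal value (for double ribbons a counting argument: the second
-- ribbon only reaches diagonal |S| ≤ |R| ≤ diagonal of the head), so the head
-- is the last cell of its row, and two consecutive ribbon additions cannot
-- have their second head strictly north-east of the first.

open import Defs
open import Data.Nat using (ℕ; _≤_)
open import Data.Product using (Σ-syntax; _×_)
open import Data.Sum using (_⊎_)
open import Data.List using (List)
open import Data.List.Relation.Unary.AllPairs using (AllPairs)
open import Data.List.Relation.Unary.Linked using (Linked)
open import Data.List.Relation.Binary.Pointwise using (Pointwise)
open import Data.List.Relation.Binary.Permutation.Propositional using (_↭_)
open import Relation.Binary.PropositionalEquality using (_≡_)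

open import Data.Nat using (zero; suc; _+_; _∸_; _<_; _>_; z≤n; s≤s; _≤?_)
open import Data.Nat.Properties
open import Data.Bool using (Bool; true; false)
open import Data.Product using (_,_; proj₁; proj₂)
open import Data.Sum using (inj₁; inj₂)
open import Data.Empty using (⊥; ⊥-elim)
open import Data.List using ([]; _∷_; length; _++_; map; applyUpTo)
open import Data.List.Properties using (length-map; length-applyUpTo; length-removeAt′)
open import Data.List.Relation.Unary.All as All using (All; []; _∷_)
import Data.List.Relation.Unary.All.Properties as All
open import Data.List.Relation.Unary.Any using (here; there; _─_)
import Data.List.Relation.Unary.AllPairs as AllPairs
import Data.List.Relation.Unary.AllPairs.Properties as AllPairs
open import Data.List.Relation.Unary.Linked using ([]; [-]; _∷_)
open import Data.List.Relation.Unary.Linked.Properties using (AllPairs⇒Linked; Linked⇒AllPairs)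
open import Data.List.Relation.Unary.Unique.Propositional using (Unique)
open import Data.List.Relation.Unary.Unique.Propositional.Properties using (applyUpTo⁺₁)
open import Data.List.Relation.Binary.Pointwise using ([]; _∷_)
open import Data.List.Relation.Binary.Pointwise.Properties using (Pointwise-length)
open import Data.List.Relation.Binary.Permutation.Propositional using (↭-refl)
open import Data.List.Membership.Propositional using (_∈_)
open import Data.List.Membership.Propositional.Properties
  using (∈-map⁺; ∈-map⁻; ∈-applyUpTo⁺; ∈-applyUpTo⁻)
open import Relation.Binary.PropositionalEquality using (refl; sym; trans; cong; subst; _≢_)
open import Relation.Nullary using (¬_; yes; no)
open import Function.Bundles using (Equivalence)

diag-right : ∀ {c r c' r'} → r ≤ suc c → c < c' → r' ≤ r → diag (c , r) < diag (c' , r')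
diag-right {c' = c'} r≤ c<c' r'≤r = <-≤-trans (∸-monoˡ-< (s≤s c<c') r≤) (∸-monoʳ-≤ (suc c') r'≤r)

diag-down : ∀ {c r c' r'} → r ≤ suc c → c ≤ c' → r' < r → diag (c , r) < diag (c' , r')
diag-down {r' = r'} r≤ c≤c' r'<r = <-≤-trans (∸-monoʳ-< r'<r r≤) (∸-monoˡ-≤ r' (s≤s c≤c'))

sh-diag-pos : ∀ {L x} → Sh L x → 1 ≤ diag x
sh-diag-pos {x = c , r} (_ , r≤c , _) = m<n⇒0<n∸m (s≤s r≤c)

suc-∸-≤ : ∀ m n → suc m ∸ n ≤ suc (m ∸ n)
suc-∸-≤ m       zero    = ≤-refl
suc-∸-≤ zero    (suc n) = ≤-trans (m∸n≤m 0 n) z≤n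
suc-∸-≤ (suc m) (suc n) = suc-∸-≤ m n

adjacent-diag : ∀ {x y} → Adjacent x y → diag y ≤ suc (diag x)
adjacent-diag {c , r}     (inj₁ (refl , inj₁ refl)) = ≤-trans (∸-monoʳ-≤ (suc c) (n≤1+n r)) (n≤1+n _)
adjacent-diag {c , suc r} (inj₁ (refl , inj₂ refl)) = suc-∸-≤ c r
adjacent-diag {c , r}     (inj₂ (refl , inj₁ refl)) = suc-∸-≤ (suc c) r
adjacent-diag {suc c , r} (inj₂ (refl , inj₂ refl)) = ≤-trans (∸-monoˡ-≤ r (n≤1+n (suc c))) (n≤1+n _)

part-step : ∀ {L} → Linked _>_ L → ∀ r → 0 < part L (suc (suc r)) → part L (suc (suc r)) < part L (suc r)
part-step {x ∷ y ∷ L} (x>y ∷ _)  zero    _   = x>y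
part-step {x ∷ y ∷ L} (_ ∷ desc) (suc r) pos = part-step desc r pos

rowEnd-antitone : ∀ {L} → Linked _>_ L → ∀ {r' r} → 1 ≤ r' → r' ≤ r → 0 < part L r →
                  r + part L r ≤ r' + part L r'
rowEnd-antitone {L} desc {r'} {r} 1≤r' r'≤r pos with m≤n⇒m<n∨m≡n r'≤r
... | inj₂ refl = ≤-refl
rowEnd-antitone {L} desc {r'} {suc (suc m)} 1≤r' r'≤r pos | inj₁ (s≤s r'≤1+m) =
  begin
    suc (suc m) + part L (suc (suc m))  ≡⟨ sym (+-suc (suc m) _) ⟩
    suc m + suc (part L (suc (suc m)))  ≤⟨ +-monoʳ-≤ (suc m) shorter ⟩
    suc m + part L (suc m)              ≤⟨ rowEnd-antitone desc 1≤r' r'≤1+m (m<n⇒0<n shorter) ⟩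
    r' + part L r'                      ∎
  where
  open ≤-Reasoning
  shorter : part L (suc (suc m)) < part L (suc m)
  shorter = part-step desc m pos
rowEnd-antitone {L} desc {suc _} {suc zero} _ _ _ | inj₁ (s≤s ())

sh-ideal : ∀ {L} → StrictPartition L → ∀ {c r c' r'} → Sh L (c , r) →
           1 ≤ r' → r' ≤ r → r' ≤ c' → c' ≤ c → Sh L (c' , r')
sh-ideal {L} (_ , desc) {c} {r} (1≤r , r≤c , c<end) 1≤r' r'≤r r'≤c' c'≤c =
  1≤r' , r'≤c' , ≤-trans (s≤s c'≤c) (≤-trans c<end (rowEnd-antitone desc 1≤r' r'≤r nonempty))
  where
  nonempty : 0 < part L r
  nonempty = +-cancelˡ-< r 0 (part L r) (subst (_< r + part L r) (sym (+-identityʳ r)) (≤-<-trans r≤c c<end))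

∈-─ : ∀ {A : Set} {a x : A} (bs : List A) (a∈ : a ∈ bs) → x ∈ bs → x ≢ a → x ∈ (bs ─ a∈)
∈-─ (b ∷ bs) (here refl) (here refl) x≢a = ⊥-elim (x≢a refl)
∈-─ (b ∷ bs) (here _)    (there x∈)  _   = x∈
∈-─ (b ∷ bs) (there a∈)  (here x≡b)  _   = here x≡b
∈-─ (b ∷ bs) (there a∈)  (there x∈)  x≢a = there (∈-─ bs a∈ x∈ x≢a)

unique-⊆-length : ∀ {A : Set} (as bs : List A) → Unique as → (∀ {x} → x ∈ as → x ∈ bs) →
                  length as ≤ length bs
unique-⊆-length []       bs _              _   = z≤n
unique-⊆-length (a ∷ as) bs (a∉as AllPairs.∷ uniq) as⊆bs = begin
  suc (length as)          ≤⟨ s≤s (unique-⊆-length as (bs ─ a∈bs) uniq as⊆bs─a) ⟩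
  suc (length (bs ─ a∈bs)) ≡⟨ sym (length-removeAt′ bs _) ⟩
  length bs                ∎
  where
  open ≤-Reasoning
  a∈bs : a ∈ bs
  a∈bs = as⊆bs (here refl)
  as⊆bs─a : ∀ {x} → x ∈ as → x ∈ (bs ─ a∈bs)
  as⊆bs─a x∈ = ∈-─ bs a∈bs (as⊆bs (there x∈)) (λ x≡a → All.lookup a∉as x∈ (sym x≡a))

interval : ℕ → List ℕ
interval = applyUpTo suc

interval-length : ∀ n → length (interval n) ≡ n
interval-length = length-applyUpTo suc

interval-unique : ∀ n → Unique (interval n)
interval-unique n = applyUpTo⁺₁ suc n (λ i<j _ e → <⇒≢ i<j (suc-injective e))

∈-interval⁺ : ∀ {n v} → 1 ≤ v → v ≤ n → v ∈ interval n
∈-interval⁺ {v = suc i} _ i<n = ∈-applyUpTo⁺ suc i<n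

∈-interval⁻ : ∀ {n v} → v ∈ interval n → 1 ≤ v × v ≤ n
∈-interval⁻ v∈ with ∈-applyUpTo⁻ suc v∈
... | _ , i<n , refl = s≤s z≤n , i<n

-- Discrete intermediate value theorem: since diagonal values grow by at most
-- one per step, an edge path from x to z meets every diagonal in between.
path-meets-diag : ∀ {S : CellSet} {x z} → Path S x z → ∀ v → diag x ≤ v → v ≤ diag z →
                  Σ[ w ∈ Cell ] (S w × diag w ≡ v)
path-meets-diag {x = x} (here Sx) v x≤v v≤z = x , Sx , ≤-antisym x≤v v≤z
path-meets-diag {x = x} (step Sx adj path) v x≤v v≤z with v ≤? diag x
... | yes v≤x = x , Sx , ≤-antisym x≤v v≤x
... | no  v≰x = path-meets-diag path v (≤-trans (adjacent-diag adj) (≰⇒> v≰x)) v≤z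

-- A connected set of b cells meeting the main diagonal meets every diagonal
-- 1, ..., diag y of each of its cells y, so all its diagonals are at most b.
connected-diag≤card : ∀ {S b t y} → EdgeConnected S → S t → diag t ≡ 1 → Card S b → S y → diag y ≤ b
connected-diag≤card {S} {b} {t} {y} conn St t-main (xs , _ , S⇔xs , len) Sy = begin
  diag y                      ≡⟨ sym (interval-length (diag y)) ⟩
  length (interval (diag y))  ≤⟨ unique-⊆-length _ _ (interval-unique (diag y)) diagonals-met ⟩
  length (map diag xs)        ≡⟨ length-map diag xs ⟩
  length xs                   ≡⟨ len ⟩
  b                           ∎
  where
  open ≤-Reasoning
  diagonals-met : ∀ {v} → v ∈ interval (diag y) → v ∈ map diag xs
  diagonals-met v∈ with ∈-interval⁻ v∈
  ... | 1≤v , v≤y with path-meets-diag (conn t y St Sy) _ (≤-trans (≤-reflexive t-main) 1≤v) v≤y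
  ... | w , Sw , refl = ∈-map⁺ diag (Equivalence.to (S⇔xs w) Sw)

card≤head-diag : ∀ {R a h} → DistinctDiagonals R → (∀ x → R x → 1 ≤ diag x) → IsHead R h → Card R a →
                 a ≤ diag h
card≤head-diag {R} {a} {h} distinct positive (_ , maximal) (xs , uniq , R⇔xs , len) = begin
  a                           ≡⟨ sym len ⟩
  length xs                   ≡⟨ sym (length-map diag xs) ⟩
  length (map diag xs)        ≤⟨ unique-⊆-length _ _ (diagonals-unique xs uniq inR) diagonals-bounded ⟩
  length (interval (diag h))  ≡⟨ interval-length (diag h) ⟩
  diag h                      ∎
  where
  open ≤-Reasoning
  inR : All R xs
  inR = All.tabulate (λ {x} x∈ → Equivalence.from (R⇔xs x) x∈)
  diagonals-unique : ∀ ys → Unique ys → All R ys → Unique (map diag ys)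
  diagonals-unique []       _                  _           = AllPairs.[]
  diagonals-unique (y ∷ ys) (y∉ys AllPairs.∷ u) (Ry ∷ Rys) =
    All.map⁺ (All.zipWith (λ (y≢z , Rz) e → y≢z (distinct y _ Ry Rz e)) (y∉ys , Rys))
      AllPairs.∷ diagonals-unique ys u Rys
  diagonals-bounded : ∀ {v} → v ∈ map diag xs → v ∈ interval (diag h)
  diagonals-bounded v∈ with ∈-map⁻ diag v∈
  ... | x , x∈ , refl = let Rx = Equivalence.from (R⇔xs x) x∈ in ∈-interval⁺ (positive x Rx) (maximal x Rx)

head∈ribbon : ∀ {k L X h} → KRibbonIn k L X h → X h
head∈ribbon (single _ _ (Xh , _)) = Xh
head∈ribbon (double _ _ _ _ _ _ _ _ _ _ _ _ _ X≐R∪S _ _ _ _ _ _ _ (Rh , _)) = proj₂ X≐R∪S _ (inj₁ Rh)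

-- For a double ribbon R ∪ S the cells of S lie on diagonals at most
-- |S| ≤ |R| ≤ diag (head R), since S starts on the main diagonal.
head-maximal : ∀ {k L X h} → KRibbonIn k L X h → X ⊆ₛ Sh L → ∀ y → X y → diag y ≤ diag h
head-maximal (single _ _ (_ , maximal)) _ = maximal
head-maximal {L = L} {h = h} (double R S a b _ tS ribbonR (_ , connS , _) _ cardR cardS b≤a _ X≐R∪S
                       _ _ _ (StS , _) _ tS-main _ (Rh , maximal)) X⊆λ y Xy
  with proj₁ X≐R∪S y Xy
... | inj₁ Ry = maximal y Ry
... | inj₂ Sy = begin
  diag y         ≤⟨ connected-diag≤card connS StS tS-main cardS Sy ⟩
  b              ≤⟨ b≤a ⟩
  a              ≤⟨ card≤head-diag (proj₂ (proj₂ (proj₂ ribbonR))) R-positive (Rh , maximal) cardR ⟩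
  diag h         ∎
  where
  open ≤-Reasoning
  R-positive : ∀ x → R x → 1 ≤ diag x
  R-positive x Rx = sh-diag-pos {L} (X⊆λ x (proj₂ X≐R∪S x (inj₁ Rx)))

module Addition {k μ L} (A : RibbonAdd k μ L) where
  open RibbonAdd A public

  head∈ : cells head
  head∈ = head∈ribbon ribbon

  head∈λ : Sh L head
  head∈λ = inside head head∈

  head-shifted : row head ≤ col head
  head-shifted = proj₁ (proj₂ head∈λ)

  head∉μ : ¬ Sh μ head
  head∉μ h∈μ = proj₂ (proj₂ removable head h∈μ) head∈

  beyond-head∈μ : ∀ x → Sh L x → diag head < diag x → Sh μ x
  beyond-head∈μ x x∈λ head<x =
    proj₁ removable x (x∈λ , λ x∈A → <⇒≱ head<x (head-maximal ribbon inside x x∈A))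

right-of-head∉λ : ∀ {k μ L} (A : RibbonAdd k μ L) →
                  ¬ Sh L (suc (col (RibbonAdd.head A)) , row (RibbonAdd.head A))
right-of-head∉λ A right∈λ =
  head∉μ (sh-ideal strictμ (beyond-head∈μ _ right∈λ head<right) (proj₁ head∈λ) ≤-refl head-shifted (n≤1+n _))
  where
  open Addition A
  head<right : diag head < diag (suc (col head) , row head)
  head<right = diag-right (m≤n⇒m≤1+n head-shifted) ≤-refl ≤-refl

-- In two consecutive additions λ₀ ⊂ λ₁ ⊂ λ₂ the second head is never strictly
-- north-east of the first: otherwise the cell in the first head's row and
-- the second head's column would be a cell of λ₁ to the right of the first
-- head.
no-northeast-step : ∀ {k L₀ L₁ L₂} (A₁ : RibbonAdd k L₀ L₁) (A₂ : RibbonAdd k L₁ L₂) → StrictPartition L₂ →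
                    col (RibbonAdd.head A₁) < col (RibbonAdd.head A₂) →
                    row (RibbonAdd.head A₁) < row (RibbonAdd.head A₂) → ⊥
no-northeast-step {L₁ = L₁} A₁ A₂ strict₂ c₁<c₂ r₁<r₂ =
  right-of-head∉λ A₁ (sh-ideal A₂.strictμ corner∈λ₁ (proj₁ A₁.head∈λ) ≤-refl
                                (m≤n⇒m≤1+n A₁.head-shifted) c₁<c₂)
  where
  module A₁ = Addition A₁
  module A₂ = Addition A₂
  corner : Cell
  corner = col A₂.head , row A₁.head
  corner∈λ₁ : Sh L₁ corner
  corner∈λ₁ = A₂.beyond-head∈μ corner
    (sh-ideal strict₂ A₂.head∈λ (proj₁ A₁.head∈λ) (<⇒≤ r₁<r₂) (≤-trans A₁.head-shifted (<⇒≤ c₁<c₂)) ≤-refl)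
    (diag-down (m≤n⇒m≤1+n A₂.head-shifted) ≤-refl r₁<r₂)

horizontal-step : ∀ {k L₀ L₁ L₂} (A₁ : RibbonAdd k L₀ L₁) (A₂ : RibbonAdd k L₁ L₂) → StrictPartition L₂ →
                  col (RibbonAdd.head A₁) < col (RibbonAdd.head A₂) → dval A₁ < dval A₂
horizontal-step A₁ A₂ strict₂ c₁<c₂ with row (RibbonAdd.head A₂) ≤? row (RibbonAdd.head A₁)
... | yes r₂≤r₁ = diag-right (m≤n⇒m≤1+n (Addition.head-shifted A₁)) c₁<c₂ r₂≤r₁
... | no  r₂≰r₁ = ⊥-elim (no-northeast-step A₁ A₂ strict₂ c₁<c₂ (≰⇒> r₂≰r₁))

vertical-step : ∀ {k L₀ L₁ L₂} (A₁ : RibbonAdd k L₀ L₁) (A₂ : RibbonAdd k L₁ L₂) → StrictPartition L₂ →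
                row (RibbonAdd.head A₁) < row (RibbonAdd.head A₂) → dval A₂ < dval A₁
vertical-step A₁ A₂ strict₂ r₁<r₂ with col (RibbonAdd.head A₂) ≤? col (RibbonAdd.head A₁)
... | yes c₂≤c₁ = diag-down (m≤n⇒m≤1+n (Addition.head-shifted A₂)) c₂≤c₁ r₁<r₂
... | no  c₂≰c₁ = ⊥-elim (no-northeast-step A₁ A₂ strict₂ (≰⇒> c₂≰c₁) r₁<r₂)

≺⇒label≤ : ∀ {a b} → a ≺ b → LRibbon.label a ≤ LRibbon.label b
≺⇒label≤ (label< a<b)         = <⇒≤ a<b
≺⇒label≤ (mark< a≡b _ _)      = ≤-reflexive a≡b
≺⇒label≤ (unmarked< a≡b _ _ _) = ≤-reflexive a≡b
≺⇒label≤ (marked< a≡b _ _ _)   = ≤-reflexive a≡b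

mark-clash : ∀ {m : Bool} → m ≡ true → m ≡ false → ⊥
mark-clash refl ()

≺-trans : ∀ {a b c} → a ≺ b → b ≺ c → a ≺ c
≺-trans (label< a<b) b≺c = label< (<-≤-trans a<b (≺⇒label≤ b≺c))
≺-trans a≺b (label< b<c) = label< (≤-<-trans (≺⇒label≤ a≺b) b<c)
≺-trans (mark< _ _ b-unmarked) (mark< _ b-marked _)         = ⊥-elim (mark-clash b-marked b-unmarked)
≺-trans (mark< _ _ b-unmarked) (marked< _ b-marked _ _)     = ⊥-elim (mark-clash b-marked b-unmarked)
≺-trans (unmarked< _ _ b-unmarked _) (mark< _ b-marked _)   = ⊥-elim (mark-clash b-marked b-unmarked)
≺-trans (unmarked< _ _ b-unmarked _) (marked< _ b-marked _ _) = ⊥-elim (mark-clash b-marked b-unmarked)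
≺-trans (marked< _ _ b-marked _) (unmarked< _ b-unmarked _ _) = ⊥-elim (mark-clash b-marked b-unmarked)
≺-trans (mark< a≡b a-marked _) (unmarked< b≡c _ c-unmarked _) = mark< (trans a≡b b≡c) a-marked c-unmarked
≺-trans (marked< a≡b a-marked _ _) (mark< b≡c _ c-unmarked) = mark< (trans a≡b b≡c) a-marked c-unmarked
≺-trans (unmarked< a≡b a-unmarked _ a<b) (unmarked< b≡c _ c-unmarked b<c) =
  unmarked< (trans a≡b b≡c) a-unmarked c-unmarked (<-trans a<b b<c)
≺-trans (marked< a≡b a-marked _ b<a) (marked< b≡c _ c-marked c<b) =
  marked< (trans a≡b b≡c) a-marked c-marked (<-trans c<b b<a)

-- Intermediate shapes of a chain of additions are strict partitions: the
-- start of a chain is the smaller shape of its first addition.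
chain-start-strict : ∀ {k μ L} → Chain k μ L → StrictPartition L → StrictPartition μ
chain-start-strict []      strict = strict
chain-start-strict (A ∷ _) _      = RibbonAdd.strictμ A

stages-start-strict : ∀ {k μ L} → Stages k μ L → StrictPartition L → StrictPartition μ
stages-start-strict end                 strict = strict
stages-start-strict (stage v _ h _ rest) strict =
  chain-start-strict v (chain-start-strict h (stages-start-strict rest strict))

horizontal-sorted : ∀ {k μ L} i (c : Chain k μ L) → StrictPartition L → HorizontalStrip c →
                    Linked _≺_ (chainRibbons i false c)
horizontal-sorted i []            _      _             = []
horizontal-sorted i (A ∷ [])      _      _             = [-]
horizontal-sorted i (A₁ ∷ A₂ ∷ c) strict (c₁<c₂ ∷ hs) =
  unmarked< refl refl refl (horizontal-step A₁ A₂ (chain-start-strict c strict) c₁<c₂)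
    ∷ horizontal-sorted i (A₂ ∷ c) strict hs

vertical-sorted : ∀ {k μ L} i (c : Chain k μ L) → StrictPartition L → VerticalStrip c →
                  Linked _≺_ (chainRibbons i true c)
vertical-sorted i []            _      _             = []
vertical-sorted i (A ∷ [])      _      _             = [-]
vertical-sorted i (A₁ ∷ A₂ ∷ c) strict (r₁<r₂ ∷ vs) =
  marked< refl refl refl (vertical-step A₁ A₂ (chain-start-strict c strict) r₁<r₂)
    ∷ vertical-sorted i (A₂ ∷ c) strict vs

record Labelled (i : ℕ) (m : Bool) (r : LRibbon) : Set where
  constructor labelled
  field
    label≡ : LRibbon.label r ≡ i
    mark≡  : LRibbon.marked r ≡ m

chain-labelled : ∀ {k μ L} i m (c : Chain k μ L) → All (Labelled i m) (chainRibbons i m c)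
chain-labelled i m []      = []
chain-labelled i m (_ ∷ c) = labelled refl refl ∷ chain-labelled i m c

stages-labels≥ : ∀ {k μ L} i (s : Stages k μ L) → All (λ r → i ≤ LRibbon.label r) (stagesRibbons i s)
stages-labels≥ i end = []
stages-labels≥ i (stage v _ h _ rest) =
  All.++⁺ (All.map at-i (chain-labelled i true v))
    (All.++⁺ (All.map at-i (chain-labelled i false h))
      (All.map (≤-trans (n≤1+n i)) (stages-labels≥ (suc i) rest)))
  where
  at-i : ∀ {m r} → Labelled i m r → i ≤ LRibbon.label r
  at-i (labelled label≡i _) = ≤-reflexive (sym label≡i)

all-precede : ∀ {P Q : LRibbon → Set} {xs ys} → (∀ {x y} → P x → Q y → x ≺ y) →
              All P xs → All Q ys → All (λ x → All (x ≺_) ys) xs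
all-precede precede Pxs Qys = All.map (λ Px → All.map (precede Px) Qys) Pxs

-- The ribbons of a sequence of stages are listed in increasing ≺-order:
-- within a strip by the two lemmas above, between strips by the labels.
stages-sorted : ∀ {k μ L} i (s : Stages k μ L) → StrictPartition L → AllPairs _≺_ (stagesRibbons i s)
stages-sorted i end _ = AllPairs.[]
stages-sorted i (stage v vs h hs rest) strict =
  AllPairs.++⁺ (Linked⇒AllPairs ≺-trans (vertical-sorted i v strict-h vs))
    (AllPairs.++⁺ (Linked⇒AllPairs ≺-trans (horizontal-sorted i h strict-rest hs))
                  (stages-sorted (suc i) rest strict)
                  (all-precede smaller-label (chain-labelled i false h) later))
    (all-precede marked-first (chain-labelled i true v)
      (All.++⁺ (All.map inj₁ (chain-labelled i false h)) (All.map inj₂ later)))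
  where
  strict-rest = stages-start-strict rest strict
  strict-h = chain-start-strict h strict-rest
  later : All (λ r → suc i ≤ LRibbon.label r) (stagesRibbons (suc i) rest)
  later = stages-labels≥ (suc i) rest
  smaller-label : ∀ {m x y} → Labelled i m x → suc i ≤ LRibbon.label y → x ≺ y
  smaller-label (labelled x≡i _) i<y = label< (≤-trans (s≤s (≤-reflexive x≡i)) i<y)
  marked-first : ∀ {x y} → Labelled i true x → Labelled i false y ⊎ suc i ≤ LRibbon.label y → x ≺ y
  marked-first (labelled x≡i x-marked) (inj₁ (labelled y≡i y-unmarked)) = mark< (trans x≡i (sym y≡i)) x-marked y-unmarked
  marked-first x-labelled       (inj₂ i<y)                = smaller-label x-labelled i<y

_++ᶜ_ : ∀ {k μ ν L} → Chain k μ ν → Chain k ν L → Chain k μ L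
[]      ++ᶜ d = d
(A ∷ c) ++ᶜ d = A ∷ (c ++ᶜ d)

stages-chain : ∀ {k μ L} → Stages k μ L → Chain k μ L
stages-chain end                  = []
stages-chain (stage v _ h _ rest) = v ++ᶜ (h ++ᶜ stages-chain rest)

CellsOf : CellSet → LRibbon → Set
CellsOf A r = A ≐ₛ LRibbon.cells r

≐ₛ-refl : ∀ {A : CellSet} → A ≐ₛ A
≐ₛ-refl = (λ _ x∈ → x∈) , (λ _ x∈ → x∈)

++ᶜ-cells : ∀ {k μ ν L} i m (c : Chain k μ ν) (d : Chain k ν L) rs →
            Pointwise CellsOf (chainCells d) rs →
            Pointwise CellsOf (chainCells (c ++ᶜ d)) (chainRibbons i m c ++ rs)
++ᶜ-cells i m []      d rs d~rs = d~rs
++ᶜ-cells i m (A ∷ c) d rs d~rs = ≐ₛ-refl ∷ ++ᶜ-cells i m c d rs d~rs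

stages-cells : ∀ {k μ L} i (s : Stages k μ L) →
               Pointwise CellsOf (chainCells (stages-chain s)) (stagesRibbons i s)
stages-cells i end                  = []
stages-cells i (stage v _ h _ rest) =
  ++ᶜ-cells i true v _ _ (++ᶜ-cells i false h _ _ (stages-cells (suc i) rest))

chainLength-cells : ∀ {k μ L} (c : Chain k μ L) → chainLength c ≡ length (chainCells c)
chainLength-cells []      = refl
chainLength-cells (_ ∷ c) = cong suc (chainLength-cells c)

mainTheorem17 : (lam : List ℕ) → StrictPartition lam → (k : ℕ) → 1 ≤ k → (n : ℕ) →
    (T : SemiStandardTableau k lam) → numRibbons T ≡ n →
    AllPairs (λ a b → (a ≺ b) ⊎ (b ≺ a)) (ribbons T)
    × (Σ[ σ ∈ List LRibbon ] ((σ ↭ ribbons T) × Linked _≺_ σ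
        × (Σ[ S ∈ StandardTableau k lam ]
             ((StandardTableau.core S ≡ SemiStandardTableau.core T)
              × (chainLength (StandardTableau.chain S) ≡ n)
              × Pointwise (λ A r → A ≐ₛ LRibbon.cells r)
                  (chainCells (StandardTableau.chain S)) σ))))
mainTheorem17 lam strict k _ n T count =
  AllPairs.map inj₁ sorted ,
  ribbons T , ↭-refl , AllPairs⇒Linked sorted ,
  St , refl , length-St , cells-St
  where
  open SemiStandardTableau T
  sorted : AllPairs _≺_ (ribbons T)
  sorted = stages-sorted 1 stages strict
  St : StandardTableau k lam
  St = record { core = core ; coreStrict = coreStrict ; isCore = isCore ; chain = stages-chain stages }
  cells-St : Pointwise CellsOf (chainCells (stages-chain stages)) (ribbons T)
  cells-St = stages-cells 1 stages
  length-St : chainLength (stages-chain stages) ≡ n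
  length-St = trans (chainLength-cells (stages-chain stages)) (trans (Pointwise-length cells-St) count)
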